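{- Let $(G,\pi)$ be a parity game, let $T$ be an $(n,d/2)$-universal tree and let $\tau_1$ be a strategy for Odd. Consider the following procedure. Set $\mu(v):=\min L(T)$ for all $v\in V$, set $\tau:=\tau_1$ and $\mu:=\mu^{\mathcal{G}^\uparrow_\tau}$. While there exists an admissible arc (an arc $vw\in E$ with $v\in V_1$ that is violated with respect to $\mu$), pivot to a new strategy $\tau'$ for Odd obtained from $\tau$ by redefining $\tau$ at one or more nodes $v\in V_1$ so that $v\tau'(v)$ is an admissible arc (the choice of which admissible arcs to use is arbitrary, given by any pivot rule), and then set $\tau:=\tau'$ and $\mu:=\mu^{\mathcal{G}^\uparrow_\tau}$. When no admissible arc exists, return $\tau,\mu$. Then, for any pivot rule, this procedure terminates and returns the pointwise minimal node labeling $\mu^*:V\to\bar L(T)$ which is feasible in $G$.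
   Context: A parity game is given by a finite directed graph $G=(V,E)$ in which every node has at least one outgoing arc, a partition $V=V_0\sqcup V_1$ (nodes of players Even and Odd), and a priority function $\pi:V\to\{1,\dots,d\}$ with $d$ even; $n=|V|$, $m=|E|$. A strategy for Odd is a map $\tau:V_1\to V$ with $v\tau(v)\in E$ for all $v\in V_1$; its strategy subgraph is $G_\tau=(V,E_\tau)$ with $E_\tau=\{vw\in E:v\in V_0\}\cup\{v\tau(v):v\in V_1\}$. A strategy for Even is a map $\sigma:V_0\to V$ with $v\sigma(v)\in E$; $G_\sigma$ contains all arcs leaving $V_1$ and, for $v\in V_0$, only the arc $v\sigma(v)$. An ordered tree $T$ is a prefix-closed set of finite tuples with entries from a linearly ordered set, viewed as a rooted tree (root = empty tuple, children of a tuple = its one-entry extensions in $T$) and linearly ordered lexicographically. In a tree of height $h$ all leaves are at depth $h$ and a leaf is written $\xi=(\xi_{2h-1},\xi_{2h-3},\dots,\xi_1)$; for $p\in\{1,\dots,2h\}$ the $p$-truncation $\xi|_p$ is obtained by deleting all components with index less than $p$. $L(T)$ is the set of leaves and $\bar L(T)=L(T)\cup\{\top\}$, where $\top$ is larger than every vertex of $T$ and $\top|_p=\top$. $T$ embeds into $T'$ ($T\sqsubseteq T'$) if there is an injective map $f:V(T)\to V(T')$ mapping edges to edges, preserving the order, and mapping leaves to leaves. An $(\ell,h)$-universal tree is an ordered tree of height $h$ into which every ordered tree of height $h$ with at most $\ell$ leaves, all at depth $h$, embeds. A node labeling is a map $\mu:V\to\bar L(T)$; labelings are ordered pointwise. An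 arc $vw$ is non-violated with respect to $\mu$ if either $\pi(v)$ is even and $\mu(v)|_{\pi(v)}\ge\mu(w)|_{\pi(v)}$, or $\pi(v)$ is odd and ($\mu(v)|_{\pi(v)}>\mu(w)|_{\pi(v)}$ or $\mu(v)=\mu(w)=\top$); otherwise it is violated. The labeling $\mu$ is feasible in a subgraph $H$ of $G$ if there is a strategy $\sigma$ for Even with $v\sigma(v)\in E(H)$ for every $v\in V_0$ having an outgoing arc in $H$, such that every arc of $H$ belonging to $G_\sigma$ is non-violated. For a strategy $\tau$ for Odd and a node labeling $\mu$, $\mu^{\mathcal{G}^\uparrow_\tau}$ denotes the pointwise least node labeling $\nu\ge\mu$ that is feasible in $G_\tau$ (such a least labeling exists). -}

module Defs where

open import Data.Nat using (ℕ; zero; suc; _∸_; _/_; _≤_; _*_)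
open import Data.Bool using (Bool; true; false; if_then_else_)
open import Data.Fin using (Fin)
open import Data.List using (List; []; _∷_; take; length; _++_; [_])
open import Data.List.Membership.Propositional using (_∈_)
open import Data.List.Relation.Unary.Unique.Propositional using (Unique)
open import Data.List.Relation.Binary.Lex.Core using (Lex-<; Lex-≤)
open import Data.Maybe using (Maybe; just; nothing)
open import Data.Vec using (Vec; toList)
open import Data.Product using (Σ; ∃; _×_; _,_)
open import Data.Sum using (_⊎_)
open import Data.Unit using (⊤)
open import Data.Empty using (⊥)
open import Relation.Nullary using (¬_)
open import Relation.Binary.PropositionalEquality using (_≡_; _≢_)
open import Relation.Binary.Construct.Closure.ReflexiveTransitive using (Star)
open import Induction.WellFounded using (Acc)
import Data.Nat as N

data Player : Set where
  even odd : Player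

-- A parity game on the node set Fin n with priorities in {1,…,2h}
-- (so d = 2h).
record Game (h : ℕ) : Set where
  field
    n        : ℕ
    E        : Fin n → Fin n → Bool
    owner    : Fin n → Player
    π        : Fin n → ℕ
    π-range  : ∀ v → 1 ≤ π v × π v ≤ 2 * h
    out      : ∀ v → ∃ λ w → E v w ≡ true

module _ {h : ℕ} (G : Game h) where
  open Game G

  Arc : Fin n → Fin n → Set
  Arc v w = E v w ≡ true

  -- A strategy for Odd, represented as a total map whose values on
  -- V₀ are irrelevant; only its restriction to V₁ matters.
  IsOddStrategy : (Fin n → Fin n) → Set
  IsOddStrategy τ = ∀ v → owner v ≡ odd → Arc v (τ v)

  IsEvenStrategy : (Fin n → Fin n) → Set
  IsEvenStrategy σ = ∀ v → owner v ≡ even → Arc v (σ v)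

  Gτ : (Fin n → Fin n) → Fin n → Fin n → Set
  Gτ τ v w = (owner v ≡ even × Arc v w) ⊎ (owner v ≡ odd × w ≡ τ v)

  Gσ : (Fin n → Fin n) → Fin n → Fin n → Set
  Gσ σ v w = (owner v ≡ odd × Arc v w) ⊎ (owner v ≡ even × w ≡ σ v)

-- Ordered trees of height h, given by their (finite) list of leaves,
-- each leaf a tuple (ξ_{2h-1}, ξ_{2h-3}, …, ξ_1) of length h.

Tree : ℕ → Set
Tree h = List (Vec ℕ h)

_<lex_ : List ℕ → List ℕ → Set
_<lex_ = Lex-< _≡_ N._<_

_≤lex_ : List ℕ → List ℕ → Set
_≤lex_ = Lex-≤ _≡_ N._<_

Vertex : {h : ℕ} → Tree h → List ℕ → Set
Vertex T u = ∃ λ ξ → ξ ∈ T × ∃ λ k → u ≡ take k (toList ξ)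

record Embedding {h : ℕ} (T T' : Tree h) (f : List ℕ → List ℕ) : Set where
  field
    vertices : ∀ {u} → Vertex T u → Vertex T' (f u)
    injective : ∀ {u u'} → Vertex T u → Vertex T u' → f u ≡ f u' → u ≡ u'
    edges    : ∀ u a → Vertex T (u ++ [ a ]) → ∃ λ b → f (u ++ [ a ]) ≡ f u ++ [ b ]
    order    : ∀ {u u'} → Vertex T u → Vertex T u' → u <lex u' → f u <lex f u'
    leaves   : ∀ ξ → ξ ∈ T → ∃ λ ξ' → ξ' ∈ T' × f (toList ξ) ≡ toList ξ'

_⊑_ : {h : ℕ} → Tree h → Tree h → Set
T ⊑ T' = ∃ λ f → Embedding T T' f

Universal : (ℓ h : ℕ) → Tree h → Set
Universal ℓ h T = ∀ (S : Tree h) → Unique S → length S ≤ ℓ → S ⊑ T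

-- Labels: elements of L̄(T) are  just ξ  (ξ a leaf) or  nothing  (= ⊤).

Label : ℕ → Set
Label h = Maybe (Vec ℕ h)

InLbar : {h : ℕ} → Tree h → Label h → Set
InLbar T nothing  = ⊤
InLbar T (just ξ) = ξ ∈ T

_≤L_ : {h : ℕ} → Label h → Label h → Set
just ξ  ≤L just ζ  = toList ξ ≤lex toList ζ
just _  ≤L nothing = ⊤
nothing ≤L just _  = ⊥
nothing ≤L nothing = ⊤

-- p-truncation: keep the components with index ≥ p, i.e. the first
-- h ∸ ⌊p/2⌋ components; ⊤|_p = ⊤ (nothing).
trunc : {h : ℕ} → ℕ → Label h → Maybe (List ℕ)
trunc {h} p nothing  = nothing
trunc {h} p (just ξ) = just (take (h ∸ p / 2) (toList ξ))

_≤T_ : Maybe (List ℕ) → Maybe (List ℕ) → Set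
just x  ≤T just y  = x ≤lex y
just _  ≤T nothing = ⊤
nothing ≤T just _  = ⊥
nothing ≤T nothing = ⊤

_<T_ : Maybe (List ℕ) → Maybe (List ℕ) → Set
just x  <T just y  = x <lex y
just _  <T nothing = ⊤
nothing <T just _  = ⊥
nothing <T nothing = ⊥

isEven : ℕ → Bool
isEven zero          = true
isEven (suc zero)    = false
isEven (suc (suc k)) = isEven k

module _ {h : ℕ} (G : Game h) (T : Tree h) where
  open Game G

  Labeling : Set
  Labeling = Fin n → Label h

  WF : Labeling → Set
  WF μ = ∀ v → InLbar T (μ v)

  _≤μ_ : Labeling → Labeling → Set
  μ ≤μ ν = ∀ v → μ v ≤L ν v

  NonViolated : Labeling → Fin n → Fin n → Set
  NonViolated μ v w =
    if isEven (π v)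
    then trunc (π v) (μ w) ≤T trunc (π v) (μ v)
    else (trunc (π v) (μ w) <T trunc (π v) (μ v) ⊎ (μ v ≡ nothing × μ w ≡ nothing))

  Feasible : (Fin n → Fin n → Set) → Labeling → Set
  Feasible H μ = ∃ λ σ → IsEvenStrategy G σ
                       × (∀ v → owner v ≡ even → (∃ λ w → H v w) → H v (σ v))
                       × (∀ v w → H v w → Gσ G σ v w → NonViolated μ v w)

  FeasibleInG : Labeling → Set
  FeasibleInG = Feasible (Arc G)

  IsLift : (Fin n → Fin n) → Labeling → Labeling → Set
  IsLift τ μ ν = WF ν × μ ≤μ ν × Feasible (Gτ G τ) ν
               × (∀ ν' → WF ν' → μ ≤μ ν' → Feasible (Gτ G τ) ν' → ν ≤μ ν')

  IsMinFeasible : Labeling → Set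
  IsMinFeasible μ = WF μ × FeasibleInG μ
                  × (∀ ν → WF ν → FeasibleInG ν → μ ≤μ ν)

  Admissible : Labeling → Fin n → Fin n → Set
  Admissible μ v w = owner v ≡ odd × Arc G v w × ¬ NonViolated μ v w

  State : Set
  State = (Fin n → Fin n) × Labeling

  Pivot : Labeling → (Fin n → Fin n) → (Fin n → Fin n) → Set
  Pivot μ τ τ' = (∀ v → τ' v ≡ τ v ⊎ Admissible μ v (τ' v))
               × (∃ λ v → τ' v ≢ τ v)

  -- one iteration of the loop (for an arbitrary pivot rule)
  Step : State → State → Set
  Step (τ , μ) (τ' , μ') = Pivot μ τ τ' × IsLift τ' μ μ'

  Terminal : State → Set
  Terminal (τ , μ) = ¬ (∃ λ v → ∃ λ w → Admissible μ v w)

  -- Step⁻¹, for well-foundedness (termination for every pivot rule)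
  StepBack : State → State → Set
  StepBack s' s = Step s s'

-- Every labeling feasible in G is feasible in every G_τ, so each lift
-- μ^{G↑τ} stays below the minimal feasible labeling μ*.  A pivot uses an
-- arc vτ'(v) violated by μ; the new lift must repair it, so μ(v) or
-- μ(τ'(v)) strictly increases.  Labels range over the finite chain L̄(T),
-- so the sum of their ranks is a bounded, strictly increasing potential.
-- Once no admissible arc is left, the Even strategy witnessing
-- feasibility in G_τ also witnesses feasibility in G, whence μ = μ*.
module Submission where

open import Defs
open import Data.Nat using (ℕ)
open import Data.Fin using (Fin)
open import Data.Vec using (Vec; toList)
open import Data.Maybe using (just)
open import Data.Product using (_×_; _,_; proj₂)
open import Data.List.Membership.Propositional using (_∈_)
open import Relation.Binary.Construct.Closure.ReflexiveTransitive using (Star)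
open import Induction.WellFounded using (Acc)

open import Data.Bool using (true; false; if_then_else_)
open import Data.Fin using (zero; suc)
open import Data.List using (List; length; filter)
open import Data.List.Membership.Propositional.Properties using (∈-filter⁺; ∈-filter⁻)
open import Data.List.Properties using (length-filter)
open import Data.List.Relation.Binary.Lex.Strict using (≤-decTotalOrder; <-decidable)
open import Data.List.Relation.Binary.Pointwise using (Pointwise-≡⇒≡)
open import Data.List.Relation.Binary.Sublist.Propositional using (_⊆_; ⊆-refl)
open import Data.List.Relation.Binary.Sublist.Propositional.Properties using (filter⁺; length-mono-≤; to-≋)
open import Data.Maybe using (nothing)
open import Data.Maybe.Properties as Maybe using ()
open import Data.Nat using (z≤n; s≤s; _≤_; _<_; _∸_)
open import Data.Nat.Induction using (<-wellFounded)
open import Data.Nat.Properties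
  using ( _≟_; _<?_; <-strictTotalOrder; +-0-monoid; ≤-refl; m≤n⇒m≤1+n
        ; +-mono-≤; +-mono-<-≤; +-mono-≤-<; ≤∧≢⇒<; ∸-monoʳ-<)
open import Algebra.Properties.Monoid.Sum +-0-monoid using (sum)
open import Data.Product using (∃)
open import Data.Sum using (_⊎_; inj₁; inj₂)
open import Data.Unit using (tt)
open import Data.Vec.Properties as Vec using (toList-injective; cast-is-id)
open import Function using (_∘_; _on_)
open import Induction.WellFounded using (WellFounded; module Subrelation)
open import Level using (Level)
open import Relation.Binary using (DecTotalOrder; DecidableEquality)
open import Relation.Binary.Construct.Closure.ReflexiveTransitive using (ε; _◅_)
import Relation.Binary.Construct.On as On
open import Relation.Binary.PropositionalEquality using (_≡_; _≢_; refl; sym; trans; cong; subst; subst₂)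
open import Relation.Nullary using (¬_; Dec; yes; no; contradiction; _⊎-dec_; _×-dec_)
open import Relation.Unary using (Pred; Decidable)

private
  module Lex≤ = DecTotalOrder (≤-decTotalOrder <-strictTotalOrder)

_≤lex?_ : (xs ys : List ℕ) → Dec (xs ≤lex ys)
_≤lex?_ = Lex≤._≤?_

_<lex?_ : (xs ys : List ℕ) → Dec (xs <lex ys)
_<lex?_ = <-decidable _≟_ _<?_

≤lex-antisym : ∀ {xs ys} → xs ≤lex ys → ys ≤lex xs → xs ≡ ys
≤lex-antisym xs≤ys ys≤xs = Pointwise-≡⇒≡ (Lex≤.antisym xs≤ys ys≤xs)

leaf-antisym : ∀ {h} {ξ ζ : Vec ℕ h} →
               toList ξ ≤lex toList ζ → toList ζ ≤lex toList ξ → ξ ≡ ζ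
leaf-antisym {ξ = ξ} {ζ} ξ≤ζ ζ≤ξ =
  trans (sym (cast-is-id refl ξ)) (toList-injective refl ξ ζ (≤lex-antisym ξ≤ζ ζ≤ξ))

module _ {a p q : Level} {A : Set a} {P : Pred A p} {Q : Pred A q}
         (P? : Decidable P) (Q? : Decidable Q) (P⇒Q : ∀ {x} → P x → Q x) where

  filter-⊆-filter : ∀ xs → filter P? xs ⊆ filter Q? xs
  filter-⊆-filter xs = filter⁺ P? Q? {as = xs} (λ { refl → P⇒Q }) ⊆-refl

  length-filter-mono : ∀ xs → length (filter P? xs) ≤ length (filter Q? xs)
  length-filter-mono xs = length-mono-≤ (filter-⊆-filter xs)

  length-filter-strictMono : ∀ {x xs} → x ∈ xs → Q x → ¬ P x →
                             length (filter P? xs) < length (filter Q? xs)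
  length-filter-strictMono {x} {xs} x∈xs Qx ¬Px =
    ≤∧≢⇒< (length-filter-mono xs) λ same-length →
      let filters-equal = Pointwise-≡⇒≡ (to-≋ {as = filter P? xs} same-length (filter-⊆-filter xs))
          x∈filterP = subst (x ∈_) (sym filters-equal) (∈-filter⁺ Q? x∈xs Qx)
      in ¬Px (proj₂ (∈-filter⁻ P? {xs = xs} x∈filterP))

sum-mono-≤ : ∀ {k} {f g : Fin k → ℕ} → (∀ i → f i ≤ g i) → sum f ≤ sum g
sum-mono-≤ {ℕ.zero}  f≤g = z≤n
sum-mono-≤ {ℕ.suc k} f≤g = +-mono-≤ (f≤g zero) (sum-mono-≤ (f≤g ∘ suc))

sum-strictMono : ∀ {k} {f g : Fin k → ℕ} → (∀ i → f i ≤ g i) → ∀ i → f i < g i →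
                 sum f < sum g
sum-strictMono f≤g zero    fi<gi = +-mono-<-≤ fi<gi (sum-mono-≤ (f≤g ∘ suc))
sum-strictMono f≤g (suc i) fi<gi = +-mono-≤-< (f≤g zero) (sum-strictMono (f≤g ∘ suc) i fi<gi)

module _ {h : ℕ} (T : Tree h) where

  rank : Label h → ℕ
  rank nothing  = ℕ.suc (length T)
  rank (just ξ) = length (filter (λ ζ → toList ζ ≤lex? toList ξ) T)

  rank-≤ : ∀ a → rank a ≤ ℕ.suc (length T)
  rank-≤ nothing  = ≤-refl
  rank-≤ (just ξ) = m≤n⇒m≤1+n (length-filter _ T)

  rank-mono : ∀ {a b} → a ≤L b → rank a ≤ rank b
  rank-mono {just ξ} {just ζ} ξ≤ζ = length-filter-mono _ _ (λ ζ'≤ξ → Lex≤.trans ζ'≤ξ ξ≤ζ) T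
  rank-mono {just ξ} {nothing} _  = rank-≤ (just ξ)
  rank-mono {nothing} {nothing} _ = ≤-refl

  rank-strictMono : ∀ {a b} → a ≤L b → InLbar T b → a ≢ b → rank a < rank b
  rank-strictMono {just ξ} {just ζ} ξ≤ζ ζ∈T ξ≢ζ =
    length-filter-strictMono _ _ (λ ζ'≤ξ → Lex≤.trans ζ'≤ξ ξ≤ζ) ζ∈T Lex≤.refl
      λ ζ≤ξ → ξ≢ζ (cong just (leaf-antisym ξ≤ζ ζ≤ξ))
  rank-strictMono {just ξ} {nothing} _ _ _    = s≤s (length-filter _ T)
  rank-strictMono {nothing} {nothing} _ _ ⊤≢⊤ = contradiction refl ⊤≢⊤

module _ {h : ℕ} (G : Game h) (T : Tree h) where
  open Game G

  -- NonViolated G T μ v w unfolds to  NonViolatedLabels (π v) (μ v) (μ w).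
  NonViolatedLabels : ℕ → Label h → Label h → Set
  NonViolatedLabels p a b =
    if isEven p
    then trunc p b ≤T trunc p a
    else (trunc p b <T trunc p a ⊎ (a ≡ nothing × b ≡ nothing))

  _≟L_ : DecidableEquality (Label h)
  _≟L_ = Maybe.≡-dec (Vec.≡-dec _≟_)

  _≤T?_ : ∀ x y → Dec (x ≤T y)
  just x  ≤T? just y  = x ≤lex? y
  just _  ≤T? nothing = yes tt
  nothing ≤T? just _  = no λ ()
  nothing ≤T? nothing = yes tt

  _<T?_ : ∀ x y → Dec (x <T y)
  just x  <T? just y  = x <lex? y
  just _  <T? nothing = yes tt
  nothing <T? just _  = no λ ()
  nothing <T? nothing = no λ ()

  nonViolatedLabels? : ∀ p a b → Dec (NonViolatedLabels p a b)
  nonViolatedLabels? p a b with isEven p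
  ... | true  = trunc p b ≤T? trunc p a
  ... | false = (trunc p b <T? trunc p a) ⊎-dec ((a ≟L nothing) ×-dec (b ≟L nothing))

  nonViolated? : ∀ μ v w → Dec (NonViolated G T μ v w)
  nonViolated? μ v w = nonViolatedLabels? (π v) (μ v) (μ w)

  repairing-changes-endpoint : ∀ {μ μ'} v w → ¬ NonViolated G T μ v w → NonViolated G T μ' v w →
                               ∃ λ u → μ u ≢ μ' u
  repairing-changes-endpoint {μ} {μ'} v w violated nonViolated
    with μ v ≟L μ' v | μ w ≟L μ' w
  ... | no  μv≢μ'v | _          = v , μv≢μ'v
  ... | yes _      | no μw≢μ'w  = w , μw≢μ'w
  ... | yes μv≡μ'v | yes μw≡μ'w =
    contradiction (subst₂ (NonViolatedLabels (π v)) (sym μv≡μ'v) (sym μw≡μ'w) nonViolated) violated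

  weight : Labeling G T → ℕ
  weight μ = sum (λ v → rank T (μ v))

  maxWeight : ℕ
  maxWeight = sum {n} (λ _ → ℕ.suc (length T))

  weight-≤-maxWeight : ∀ μ → weight μ ≤ maxWeight
  weight-≤-maxWeight μ = sum-mono-≤ (rank-≤ T ∘ μ)

  weight-strictMono : ∀ {μ μ'} → _≤μ_ G T μ μ' → WF G T μ' → (∃ λ u → μ u ≢ μ' u) →
                      weight μ < weight μ'
  weight-strictMono μ≤μ' wf' (u , μu≢μ'u) =
    sum-strictMono (rank-mono T ∘ μ≤μ') u (rank-strictMono T (μ≤μ' u) (wf' u) μu≢μ'u)

  step-increases-weight : ∀ {s s'} → Step G T s s' → weight (proj₂ s) < weight (proj₂ s')
  step-increases-weight ((changes , v , moved) , wf' , μ≤μ' , (_ , _ , _ , nonViolated') , _)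
    with changes v
  ... | inj₁ unmoved                 = contradiction unmoved moved
  ... | inj₂ (v-odd , arc , violated) =
    weight-strictMono μ≤μ' wf'
      (repairing-changes-endpoint v _ violated (nonViolated' v _ (inj₂ (v-odd , refl)) (inj₁ (v-odd , arc))))

  StepBack-wellFounded : WellFounded (StepBack G T)
  StepBack-wellFounded = Subrelation.wellFounded decreases (On.wellFounded potential <-wellFounded)
    where
      potential : State G T → ℕ
      potential (_ , μ) = maxWeight ∸ weight μ

      decreases : ∀ {s' s} → StepBack G T s' s → (_<_ on potential) s' s
      decreases {_ , μ'} step = ∸-monoʳ-< (step-increases-weight step) (weight-≤-maxWeight μ')

  feasibleInG⇒feasibleInGτ : ∀ {τ ν} → IsOddStrategy G τ → FeasibleInG G T ν →
                             Feasible G T (Gτ G τ) ν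
  feasibleInG⇒feasibleInGτ {τ} {ν} τ-odd (σ , σ-even , _ , nonViolated) =
    σ , σ-even , (λ v v-even _ → inj₁ (v-even , σ-even v v-even)) , nonViolatedInGτ
    where
      nonViolatedInGτ : ∀ v w → Gτ G τ v w → Gσ G σ v w → NonViolated G T ν v w
      nonViolatedInGτ v w (inj₁ (_ , arc))    = nonViolated v w arc
      nonViolatedInGτ v w (inj₂ (v-odd , refl)) = nonViolated v w (τ-odd v v-odd)

  BelowFeasible : Labeling G T → Set
  BelowFeasible μ = ∀ ν → WF G T ν → FeasibleInG G T ν → _≤μ_ G T μ ν

  lift-belowFeasible : ∀ {τ μ μ'} → IsOddStrategy G τ → IsLift G T τ μ μ' →
                       BelowFeasible μ → BelowFeasible μ'
  lift-belowFeasible τ-odd (_ , _ , _ , least) μ≤ ν wf feasible =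
    least ν wf (μ≤ ν wf feasible) (feasibleInG⇒feasibleInGτ τ-odd feasible)

  pivot-preserves-strategy : ∀ {μ τ τ'} → Pivot G T μ τ τ' →
                             IsOddStrategy G τ → IsOddStrategy G τ'
  pivot-preserves-strategy (changes , _) τ-odd v v-odd with changes v
  ... | inj₁ unmoved      = subst (Arc G v) (sym unmoved) (τ-odd v v-odd)
  ... | inj₂ (_ , arc , _) = arc

  Invariant : State G T → Set
  Invariant (τ , μ) = IsOddStrategy G τ × WF G T μ × Feasible G T (Gτ G τ) μ × BelowFeasible μ

  step-preserves-invariant : ∀ {s s'} → Invariant s → Step G T s s' → Invariant s'
  step-preserves-invariant (τ-odd , _ , _ , μ≤) (pivot , lift@(wf' , _ , feasible' , _)) =
    τ'-odd , wf' , feasible' , lift-belowFeasible τ'-odd lift μ≤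
    where τ'-odd = pivot-preserves-strategy pivot τ-odd

  steps-preserve-invariant : ∀ {s s'} → Invariant s → Star (Step G T) s s' → Invariant s'
  steps-preserve-invariant inv ε            = inv
  steps-preserve-invariant inv (step ◅ run) =
    steps-preserve-invariant (step-preserves-invariant inv step) run

  terminal-minFeasible : ∀ {s} → Invariant s → Terminal G T s → IsMinFeasible G T (proj₂ s)
  terminal-minFeasible {_ , μ} (_ , wf , (σ , σ-even , _ , nonViolated) , μ≤) terminal =
    wf , (σ , σ-even , (λ v v-even _ → σ-even v v-even) , nonViolatedInG) , μ≤
    where
      nonViolatedInG : ∀ v w → Arc G v w → Gσ G σ v w → NonViolated G T μ v w
      nonViolatedInG v w arc σ-arc@(inj₂ (v-even , _)) = nonViolated v w (inj₁ (v-even , arc)) σ-arc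
      nonViolatedInG v w arc (inj₁ (v-odd , _)) with nonViolated? μ v w
      ... | yes ok      = ok
      ... | no violated = contradiction (v , w , v-odd , arc , violated) terminal

theorem3p1 : ∀ {h : ℕ} (G : Game h) (T : Tree h)
    → Universal (Game.n G) h T
    → (τ₁ : Fin (Game.n G) → Fin (Game.n G)) → IsOddStrategy G τ₁
    → (ξmin : Vec ℕ h) → ξmin ∈ T → (∀ ξ → ξ ∈ T → toList ξmin ≤lex toList ξ)
    → (μ₁ : Labeling G T) → IsLift G T τ₁ (λ _ → just ξmin) μ₁
    → Acc (StepBack G T) (τ₁ , μ₁)
    × (∀ s → Star (Step G T) (τ₁ , μ₁) s → Terminal G T s → IsMinFeasible G T (proj₂ s))
theorem3p1 G T _ τ₁ τ₁-odd ξmin _ ξmin-least μ₁ lift@(wf₁ , _ , feasible₁ , _) =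
    StepBack-wellFounded G T (τ₁ , μ₁)
  , λ _ run → terminal-minFeasible G T (steps-preserve-invariant G T initial run)
  where
    minimum-belowFeasible : BelowFeasible G T (λ _ → just ξmin)
    minimum-belowFeasible ν wf _ v with ν v | wf v
    ... | nothing | _   = tt
    ... | just ξ  | ξ∈T = ξmin-least ξ ξ∈T

    initial : Invariant G T (τ₁ , μ₁)
    initial = τ₁-odd , wf₁ , feasible₁ , lift-belowFeasible G T τ₁-odd lift minimum-belowFeasible
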